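{- Let $n\ge 1$ and $k\ge 3$ be integers and let $G_n(k)$ be a $k$-regular caterpillar with central path $P_n=v_1v_2\cdots v_n$, i.e. every vertex $v_i$ of $P_n$ satisfies $l(v_i)=k$. Then $\lambda_H(G_n(k))=n(k-1)$.
   Context: A caterpillar graph is a tree containing a path $P_n$ on $n$ vertices (its central path) such that every vertex of the graph is at distance at most $1$ from $P_n$; every vertex not on $P_n$ is a leaf (vertex of degree $1$) adjacent to a vertex of $P_n$. For a vertex $v$, $l(v)$ denotes the number of leaves adjacent to $v$. A $k$-regular caterpillar $G_n(k)$ is a caterpillar with central path $P_n$ in which $l(v_i)=k$ for every $v_i\in V(P_n)$. For a graph $G$, the Hamiltonian complete number $\lambda_H(G)$ is the minimum number of edges not in $E(G)$, joining vertices of $G$, whose addition to $G$ produces a graph containing a Hamiltonian (spanning) cycle. -}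

module Defs where

open import Data.Nat using (ℕ; zero; suc; _≤_)
open import Data.Fin using (Fin; zero; suc; toℕ)
open import Data.Product using (Σ; _×_; _,_)
open import Data.Sum using (_⊎_)
open import Data.List using (List; []; _∷_; _++_; length)
open import Data.List.Membership.Propositional using (_∈_)
open import Data.List.Relation.Unary.Unique.Propositional using (Unique)
open import Data.List.Relation.Unary.AllPairs using (AllPairs)
open import Data.List.Relation.Unary.Linked using (Linked)
open import Relation.Binary.PropositionalEquality using (_≡_)
open import Relation.Nullary using (¬_)
open import Data.Empty using (⊥)

-- The k-regular caterpillar G_n(k).
-- Vertex (i , zero)    is the path vertex v_{i+1}  (i : Fin n),
-- vertex (i , suc l)   is the (l+1)-th leaf attached to v_{i+1} (l : Fin k).

CatVertex : ℕ → ℕ → Set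
CatVertex n k = Fin n × Fin (suc k)

data CatAdj (n k : ℕ) : CatVertex n k → CatVertex n k → Set where
  pathFwd : {i j : Fin n} → toℕ j ≡ suc (toℕ i) → CatAdj n k (i , zero) (j , zero)
  pathBwd : {i j : Fin n} → toℕ i ≡ suc (toℕ j) → CatAdj n k (i , zero) (j , zero)
  toLeaf  : {i : Fin n} {l : Fin k} → CatAdj n k (i , zero) (i , suc l)
  fromLeaf : {i : Fin n} {l : Fin k} → CatAdj n k (i , suc l) (i , zero)

AddEdges : {V : Set} → (V → V → Set) → List (V × V) → V → V → Set
AddEdges Adj F u v = Adj u v ⊎ ((u , v) ∈ F ⊎ (v , u) ∈ F)

SameEdge : {V : Set} → V × V → V × V → Set
SameEdge (a , b) (c , d) = ((a , b) ≡ (c , d)) ⊎ ((a , b) ≡ (d , c))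

NewEdges : {V : Set} → (V → V → Set) → List (V × V) → Set
NewEdges {V} Adj F =
  ((e : V × V) → e ∈ F → Σ V λ u → Σ V λ v → (e ≡ (u , v)) × (¬ (u ≡ v)) × (¬ Adj u v))
  × AllPairs (λ e f → ¬ SameEdge e f) F

HamiltonianCycle : {V : Set} → (V → V → Set) → List V → Set
HamiltonianCycle Adj [] = ⊥
HamiltonianCycle {V} Adj (x ∷ xs) =
  Unique (x ∷ xs) × ((v : V) → v ∈ (x ∷ xs)) × (3 ≤ length (x ∷ xs))
  × Linked Adj ((x ∷ xs) ++ (x ∷ []))

Hamiltonian : {V : Set} → (V → V → Set) → Set
Hamiltonian {V} Adj = Σ (List V) λ c → HamiltonianCycle Adj c

HamiltonianCompleteNumber : {V : Set} → (V → V → Set) → ℕ → Set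
HamiltonianCompleteNumber {V} Adj m =
  (Σ (List (V × V)) λ F → NewEdges Adj F × (length F ≡ m) × Hamiltonian (AddEdges Adj F))
  × ((F : List (V × V)) → NewEdges Adj F → Hamiltonian (AddEdges Adj F) → m ≤ length F)

-- A Hamiltonian cycle of G_n(k) has n(k+1) edges. Give path vertices weight 1 and leaves
-- weight 0: every edge of G_n(k) has weight at least 1, while the weights of the cycle edges
-- add up to twice the number n of path vertices, so at most 2n cycle edges lie in G_n(k) and
-- at least n(k+1) − 2n = n(k−1) must be added. Conversely, the cycle that visits, for each i
-- in turn, a leaf of v_i, then v_i, then its remaining leaves uses exactly 2n edges of G_n(k).
module Submission where

open import Data.Empty using (⊥)
open import Data.Fin using (Fin; zero; suc; toℕ)
open import Data.Fin.Properties using (suc-injective) renaming (_≟_ to _≟ᶠ_)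
open import Data.List using (List; []; _∷_; _++_; [_]; length; map; filter; tabulate; allFin; cartesianProduct)
open import Data.List.Membership.Propositional using (_∈_)
open import Data.List.Membership.Propositional.Properties
  using (∈-filter⁺; ∈-filter⁻; ∈-tabulate⁺; ∈-allFin; ∈-cartesianProduct⁺)
open import Data.List.Membership.Propositional.Properties.WithK using (unique∧set⇒bag)
open import Data.List.Properties using (++-assoc; length-++; length-map; length-tabulate; map-++; length-removeAt′)
open import Data.List.Relation.Binary.BagAndSetEquality using (∼bag⇒↭)
open import Data.List.Relation.Binary.Permutation.Propositional using (_↭_)
open import Data.List.Relation.Binary.Permutation.Propositional.Properties using (↭-length)
import Data.List.Relation.Binary.Permutation.Propositional.Properties as ↭
open import Data.List.Relation.Unary.All as All using (All; []; _∷_)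
import Data.List.Relation.Unary.All.Properties as All
open import Data.List.Relation.Unary.AllPairs as AllPairs using (AllPairs; []; _∷_)
import Data.List.Relation.Unary.AllPairs.Properties as AllPairs
open import Data.List.Relation.Unary.Any using (here; there; index; _─_)
open import Data.List.Relation.Unary.Linked using (Linked; []; [-]; _∷_)
open import Data.List.Relation.Unary.Unique.Propositional using (Unique)
import Data.List.Relation.Unary.Unique.Propositional.Properties as Unique
open import Data.Nat using (ℕ; zero; suc; _≟_; _+_; _*_; _∸_; _≤_; z≤n; s≤s)
open import Data.Nat.ListAction using (sum)
open import Data.Nat.ListAction.Properties using (sum-++; sum-↭)
open import Data.Nat.Properties
  using (module ≤-Reasoning; +-commutativeSemigroup; +-suc; ≤-trans; +-mono-≤; +-monoʳ-≤; m≤n+m; +-cancelʳ-≤; +-cancelʳ-≡; *-zeroʳ; +-comm; ≤-reflexive)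
open import Algebra.Properties.CommutativeSemigroup +-commutativeSemigroup using (x∙yz≈y∙xz)
open import Data.Nat.Tactic.RingSolver using (solve-∀)
open import Data.Product using (∃-syntax; _×_; _,_; proj₁; proj₂; uncurry)
open import Data.Sum using (_⊎_; inj₁; inj₂)
open import Function.Base using (id; _∘_)
open import Function.Bundles using (mk⇔)
open import Relation.Binary.Definitions using (Decidable)
open import Relation.Binary.PropositionalEquality using (_≡_; _≢_; refl; sym; trans; subst; cong; cong₂; module ≡-Reasoning)
open import Relation.Nullary using (¬_; yes; no; ¬?; contradiction)
import Relation.Unary as Unary

open import Defs

module _ {A : Set} where

  ∈-─ : ∀ {x y : A} {ys} (x∈ys : x ∈ ys) → y ∈ ys → y ≢ x → y ∈ (ys ─ x∈ys)
  ∈-─ (here refl) (here refl)   y≢x = contradiction refl y≢x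
  ∈-─ (here refl) (there y∈ys)  _   = y∈ys
  ∈-─ (there _)   (here refl)   _   = here refl
  ∈-─ (there x∈ys) (there y∈ys) y≢x = there (∈-─ x∈ys y∈ys y≢x)

  complete-unique⇒↭ : ∀ {xs ys : List A} → Unique xs → Unique ys →
                      (∀ v → v ∈ xs) → (∀ v → v ∈ ys) → xs ↭ ys
  complete-unique⇒↭ xs! ys! xs-complete ys-complete =
    ∼bag⇒↭ (unique∧set⇒bag xs! ys! (mk⇔ (λ _ → ys-complete _) (λ _ → xs-complete _)))

  unique-rotate : ∀ {x : A} {xs} → Unique (x ∷ xs) → Unique (xs ++ [ x ])
  unique-rotate (x∉xs ∷ xs!) =
    Unique.++⁺ xs! ([] ∷ []) (λ { (x∈xs , here refl) → All.lookup x∉xs x∈xs refl })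

module _ {A B : Set} (R : A → B → Set) where

  matching⇒length≤ : ∀ {xs ys} →
    AllPairs (λ a a′ → ∀ {b} → R a b → R a′ b → ⊥) xs →
    (∀ {a} → a ∈ xs → ∃[ b ] b ∈ ys × R a b) →
    length xs ≤ length ys
  matching⇒length≤ {[]}     _                    _     = z≤n
  matching⇒length≤ {a ∷ xs} {ys} (a-apart ∷ xs-apart) match with match (here refl)
  ... | b , b∈ys , Rab = ≤-trans (s≤s (matching⇒length≤ xs-apart match′))
                                 (≤-reflexive (sym (length-removeAt′ ys (index b∈ys))))
    where
    match′ : ∀ {a′} → a′ ∈ xs → ∃[ b′ ] b′ ∈ (ys ─ b∈ys) × R a′ b′
    match′ a′∈xs with match (there a′∈xs)
    ... | b′ , b′∈ys , Ra′b′ =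
      b′ , ∈-─ b∈ys b′∈ys (λ { refl → All.lookup a-apart a′∈xs Rab Ra′b′ }) , Ra′b′

length-cartesianProduct : ∀ {A B : Set} (xs : List A) (ys : List B) →
                          length (cartesianProduct xs ys) ≡ length xs * length ys
length-cartesianProduct []       ys = refl
length-cartesianProduct (x ∷ xs) ys = trans (length-++ (map (x ,_) ys))
  (cong₂ _+_ (length-map (x ,_) ys) (length-cartesianProduct xs ys))

module _ {A : Set} where

  steps : List A → List (A × A)
  steps []          = []
  steps (_ ∷ [])    = []
  steps (a ∷ b ∷ r) = (a , b) ∷ steps (b ∷ r)

  closedWalk : List A → List A
  closedWalk []       = []
  closedWalk (x ∷ xs) = x ∷ xs ++ [ x ]

  cycleEdges : List A → List (A × A)
  cycleEdges c = steps (closedWalk c)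

  Linked⇒All-steps : ∀ {R : A → A → Set} {xs} → Linked R xs → All (uncurry R) (steps xs)
  Linked⇒All-steps []         = []
  Linked⇒All-steps [-]        = []
  Linked⇒All-steps (r ∷ rs)   = r ∷ Linked⇒All-steps rs

  All-steps⇒Linked : ∀ {R : A → A → Set} xs → All (uncurry R) (steps xs) → Linked R xs
  All-steps⇒Linked []          _        = []
  All-steps⇒Linked (_ ∷ [])    _        = [-]
  All-steps⇒Linked (_ ∷ _ ∷ r) (p ∷ ps) = p ∷ All-steps⇒Linked (_ ∷ r) ps

  ∈-steps⁻ : ∀ {e} b r → e ∈ steps (b ∷ r) → proj₁ e ∈ b ∷ r × proj₂ e ∈ r
  ∈-steps⁻ b (c ∷ r) (here refl) = here refl , here refl
  ∈-steps⁻ b (c ∷ r) (there e∈) with ∈-steps⁻ c r e∈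
  ... | p , q = there p , there q

  length-steps : ∀ a r → length (steps (a ∷ r)) ≡ length r
  length-steps a []      = refl
  length-steps a (b ∷ r) = cong suc (length-steps b r)

  length-cycleEdges : ∀ c → length (cycleEdges c) ≡ length c
  length-cycleEdges []       = refl
  length-cycleEdges (x ∷ xs) = begin
    length (steps (x ∷ xs ++ [ x ])) ≡⟨ length-steps x (xs ++ [ x ]) ⟩
    length (xs ++ [ x ])             ≡⟨ length-++ xs ⟩
    length xs + 1                    ≡⟨ +-comm (length xs) 1 ⟩
    suc (length xs)                  ∎
    where open ≡-Reasoning

  Apart : A × A → A × A → Set
  Apart e f = ¬ SameEdge e f

  sameEdge-sym : ∀ {e f : A × A} → SameEdge e f → SameEdge f e
  sameEdge-sym (inj₁ refl) = inj₁ refl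
  sameEdge-sym (inj₂ refl) = inj₂ refl

  sameEdge-trans : ∀ {e f g : A × A} → SameEdge e f → SameEdge f g → SameEdge e g
  sameEdge-trans (inj₁ refl) f~g         = f~g
  sameEdge-trans (inj₂ refl) (inj₁ refl) = inj₂ refl
  sameEdge-trans (inj₂ refl) (inj₂ refl) = inj₁ refl

  steps-loopless : ∀ {e} xs → Unique xs → e ∈ steps xs → proj₁ e ≢ proj₂ e
  steps-loopless (a ∷ b ∷ r) ((a≢b ∷ _) ∷ _) (here refl) = a≢b
  steps-loopless (a ∷ b ∷ r) (_ ∷ xs!)       (there e∈)  = steps-loopless (b ∷ r) xs! e∈

  steps-apart : ∀ xs → Unique xs → AllPairs Apart (steps xs)
  steps-apart []          _             = []
  steps-apart (_ ∷ [])    _             = []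
  steps-apart (a ∷ b ∷ r) (a∉ ∷ xs!) = All.tabulate apart ∷ steps-apart (b ∷ r) xs!
    where
    apart : ∀ {e} → e ∈ steps (b ∷ r) → Apart (a , b) e
    apart e∈ (inj₁ refl) = All.lookup a∉ (proj₁ (∈-steps⁻ b r e∈)) refl
    apart e∈ (inj₂ refl) = All.lookup a∉ (there (proj₂ (∈-steps⁻ b r e∈))) refl

  cycleEdges-loopless : ∀ {e} x y zs → Unique (x ∷ y ∷ zs) →
                        e ∈ cycleEdges (x ∷ y ∷ zs) → proj₁ e ≢ proj₂ e
  cycleEdges-loopless x y zs ((x≢y ∷ _) ∷ _) (here refl) = x≢y
  cycleEdges-loopless x y zs c! (there e∈) =
    steps-loopless (y ∷ zs ++ [ x ]) (unique-rotate c!) e∈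

  cycleEdges-apart : ∀ x y z zs → Unique (x ∷ y ∷ z ∷ zs) → AllPairs Apart (cycleEdges (x ∷ y ∷ z ∷ zs))
  cycleEdges-apart x y z zs c!@((x≢y ∷ x≢z ∷ _) ∷ _) =
    All.tabulate apart ∷ steps-apart (y ∷ z ∷ zs ++ [ x ]) rotated!
    where
    rotated! : Unique (y ∷ z ∷ zs ++ [ x ])
    rotated! = unique-rotate c!
    y∉ : All (y ≢_) (z ∷ zs ++ [ x ])
    y∉ = AllPairs.head rotated!
    apart : ∀ {e} → e ∈ steps (y ∷ z ∷ zs ++ [ x ]) → Apart (x , y) e
    apart (here refl) (inj₁ refl) = x≢y refl
    apart (here refl) (inj₂ refl) = x≢z refl
    apart (there e∈)  (inj₁ refl) = All.lookup y∉ (there (proj₂ (∈-steps⁻ z (zs ++ [ x ]) e∈))) refl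
    apart (there e∈)  (inj₂ refl) = All.lookup y∉ (proj₁ (∈-steps⁻ z (zs ++ [ x ]) e∈)) refl

  hamiltonianCycle-unique-complete : ∀ {R : A → A → Set} c → HamiltonianCycle R c →
                                     Unique c × (∀ v → v ∈ c)
  hamiltonianCycle-unique-complete (_ ∷ _) (c! , c-complete , _) = c! , c-complete

  module _ (w : A → ℕ) where

    weight : List A → ℕ
    weight xs = sum (map w xs)

    weight-++ : ∀ xs ys → weight (xs ++ ys) ≡ weight xs + weight ys
    weight-++ xs ys = trans (cong sum (map-++ w xs ys)) (sum-++ (map w xs) (map w ys))

    weight-zero : ∀ {xs} → All (λ x → w x ≡ 0) xs → weight xs ≡ 0
    weight-zero []         = refl
    weight-zero (w≡0 ∷ ps) = cong₂ _+_ w≡0 (weight-zero ps)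

    pairWeight : A × A → ℕ
    pairWeight (a , b) = w a + w b

    pairWeight-steps : ∀ y r z →
      sum (map pairWeight (steps (y ∷ r ++ [ z ]))) ≡ w y + (weight r + weight r) + w z
    pairWeight-steps y []      z = regroup (w y) (w z)
      where
      regroup : ∀ a b → (a + b) + 0 ≡ a + 0 + b
      regroup = solve-∀
    pairWeight-steps y (x ∷ r) z = begin
      (w y + w x) + sum (map pairWeight (steps (x ∷ r ++ [ z ])))
        ≡⟨ cong ((w y + w x) +_) (pairWeight-steps x r z) ⟩
      (w y + w x) + (w x + (weight r + weight r) + w z)
        ≡⟨ regroup (w y) (w x) (weight r) (w z) ⟩
      w y + ((w x + weight r) + (w x + weight r)) + w z ∎
      where
      open ≡-Reasoning
      regroup : ∀ a b s d → (a + b) + (b + (s + s) + d) ≡ a + ((b + s) + (b + s)) + d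
      regroup = solve-∀

    pairWeight-cycleEdges : ∀ c → sum (map pairWeight (cycleEdges c)) ≡ weight c + weight c
    pairWeight-cycleEdges []       = refl
    pairWeight-cycleEdges (x ∷ xs) = trans (pairWeight-steps x xs x) (regroup (w x) (weight xs))
      where
      regroup : ∀ a s → a + (s + s) + a ≡ (a + s) + (a + s)
      regroup = solve-∀

module MissingEdges {V : Set} {Adj : V → V → Set} (adj? : Decidable Adj) where

  NonAdjacent : V × V → Set
  NonAdjacent (a , b) = ¬ Adj a b

  nonAdjacent? : Unary.Decidable NonAdjacent
  nonAdjacent? (a , b) = ¬? (adj? a b)

  missing : List (V × V) → List (V × V)
  missing = filter nonAdjacent?

  missingEdges : List V → List (V × V)
  missingEdges c = missing (cycleEdges c)

  missingEdges-≤ : ∀ F c → HamiltonianCycle (AddEdges Adj F) c → length (missingEdges c) ≤ length F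
  missingEdges-≤ F (_ ∷ [])     (_ , _ , s≤s ()       , _)
  missingEdges-≤ F (_ ∷ _ ∷ []) (_ , _ , s≤s (s≤s ()) , _)
  missingEdges-≤ F c@(x ∷ y ∷ z ∷ zs) (c! , _ , _ , linked) = matching⇒length≤ SameEdge apart matched
    where
    apart : AllPairs (λ e e′ → ∀ {f} → SameEdge e f → SameEdge e′ f → ⊥) (missingEdges c)
    apart = AllPairs.map (λ e≁e′ {_} e~f e′~f → e≁e′ (sameEdge-trans e~f (sameEdge-sym e′~f)))
                         (AllPairs.filter⁺ nonAdjacent? (cycleEdges-apart x y z zs c!))
    matched : ∀ {e} → e ∈ missingEdges c → ∃[ f ] f ∈ F × SameEdge e f
    matched {a , b} e∈ with ∈-filter⁻ nonAdjacent? e∈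
    ... | e∈c , ¬adj with All.lookup (Linked⇒All-steps linked) e∈c
    ...   | inj₁ adj           = contradiction adj ¬adj
    ...   | inj₂ (inj₁ ab∈F)   = (a , b) , ab∈F , inj₁ refl
    ...   | inj₂ (inj₂ ba∈F)   = (b , a) , ba∈F , inj₂ refl

  missingEdges-complete : ∀ c → Unique c → (∀ v → v ∈ c) → 3 ≤ length c →
    NewEdges Adj (missingEdges c) × Hamiltonian (AddEdges Adj (missingEdges c))
  missingEdges-complete (_ ∷ [])     _ _ (s≤s ())
  missingEdges-complete (_ ∷ _ ∷ []) _ _ (s≤s (s≤s ()))
  missingEdges-complete c@(x ∷ y ∷ z ∷ zs) c! c-complete 3≤ = newEdges , c , c! , c-complete , 3≤ , linked
    where
    newEdges : NewEdges Adj (missingEdges c)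
    newEdges = (λ e e∈ → let e∈c , ¬adj = ∈-filter⁻ nonAdjacent? e∈ in
                  proj₁ e , proj₂ e , refl , cycleEdges-loopless x y (z ∷ zs) c! e∈c , ¬adj)
             , AllPairs.filter⁺ nonAdjacent? (cycleEdges-apart x y z zs c!)
    linked : Linked (AddEdges Adj (missingEdges c)) (closedWalk c)
    linked = All-steps⇒Linked (closedWalk c) (All.tabulate added)
      where
      added : ∀ {e} → e ∈ cycleEdges c → AddEdges Adj (missingEdges c) (proj₁ e) (proj₂ e)
      added {a , b} e∈ with adj? a b
      ... | yes adj = inj₁ adj
      ... | no ¬adj = inj₂ (inj₁ (∈-filter⁺ nonAdjacent? e∈ ¬adj))

  hamiltonianCompleteNumber-intro : ∀ {m} c → Unique c → (∀ v → v ∈ c) → 3 ≤ length c →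
    length (missingEdges c) ≡ m →
    (∀ c′ → Unique c′ → (∀ v → v ∈ c′) → m ≤ length (missingEdges c′)) →
    HamiltonianCompleteNumber Adj m
  hamiltonianCompleteNumber-intro c c! c-complete 3≤ ∣missing∣≡m lower =
    let newEdges , ham = missingEdges-complete c c! c-complete 3≤ in
    (missingEdges c , newEdges , ∣missing∣≡m , ham) ,
    λ { F _ (c′ , ham′) → let c′! , c′-complete = hamiltonianCycle-unique-complete c′ ham′ in
                          ≤-trans (lower c′ c′! c′-complete) (missingEdges-≤ F c′ ham′) }

  module _ (w : V → ℕ) where

    Tight : V → V → Set
    Tight a b = (Adj a b × w a + w b ≡ 1) ⊎ (¬ Adj a b × w a + w b ≡ 0)

    CoversEdges : Set
    CoversEdges = ∀ {a b} → Adj a b → 1 ≤ w a + w b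

    module _ (cover : CoversEdges) where

      length≤missing+pairWeight : ∀ es → length es ≤ length (missing es) + sum (map (pairWeight w) es)
      length≤missing+pairWeight []             = z≤n
      length≤missing+pairWeight ((a , b) ∷ es) with adj? a b
      ... | yes adj = ≤-trans (+-mono-≤ (cover adj) (length≤missing+pairWeight es))
                              (≤-reflexive (x∙yz≈y∙xz (w a + w b) (length (missing es)) _))
      ... | no  _   = s≤s (≤-trans (length≤missing+pairWeight es)
                                   (+-monoʳ-≤ (length (missing es)) (m≤n+m _ (w a + w b))))

      weightless⇒tight : ∀ {a b} → w a ≡ 0 → w b ≡ 0 → Tight a b
      weightless⇒tight wa≡0 wb≡0 = inj₂ ((λ adj → contradiction (subst (1 ≤_) wab≡0 (cover adj)) λ ()) , wab≡0)
        where
        wab≡0 : w _ + w _ ≡ 0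
        wab≡0 = cong₂ _+_ wa≡0 wb≡0

      weightless-++⁺ : ∀ {xs v ys} → All (λ x → w x ≡ 0) xs → w v ≡ 0 →
                       Linked Tight (v ∷ ys) → Linked Tight (xs ++ v ∷ ys)
      weightless-++⁺ []                   _    linked = linked
      weightless-++⁺ (wx≡0 ∷ [])          wv≡0 linked = weightless⇒tight wx≡0 wv≡0 ∷ linked
      weightless-++⁺ (wx≡0 ∷ wx′≡0 ∷ ws) wv≡0 linked =
        weightless⇒tight wx≡0 wx′≡0 ∷ weightless-++⁺ (wx′≡0 ∷ ws) wv≡0 linked

    tight⇒missing+pairWeight≡length : ∀ es → All (uncurry Tight) es →
      length (missing es) + sum (map (pairWeight w) es) ≡ length es
    tight⇒missing+pairWeight≡length []             []          = refl
    tight⇒missing+pairWeight≡length ((a , b) ∷ es) (tab ∷ tight) with adj? a b | tab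
    ... | yes _   | inj₁ (_ , wab≡1) rewrite wab≡1 =
      trans (+-suc _ _) (cong suc (tight⇒missing+pairWeight≡length es tight))
    ... | yes adj | inj₂ (¬adj , _)  = contradiction adj ¬adj
    ... | no ¬adj | inj₁ (adj , _)   = contradiction adj ¬adj
    ... | no _    | inj₂ (_ , wab≡0) rewrite wab≡0 = cong suc (tight⇒missing+pairWeight≡length es tight)

n[k+1]≡n[k∸1]+2n : ∀ n k → 1 ≤ k → n * suc k ≡ n * (k ∸ 1) + (n + n)
n[k+1]≡n[k∸1]+2n n (suc j) _ = expand n j
  where
  expand : ∀ n j → n * suc (suc j) ≡ n * j + (n + n)
  expand = solve-∀

n[k+1]≤m+2n⇒n[k∸1]≤m : ∀ n k m → n * suc k ≤ m + (n + n) → n * (k ∸ 1) ≤ m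
n[k+1]≤m+2n⇒n[k∸1]≤m n zero    m _  = subst (_≤ m) (sym (*-zeroʳ n)) z≤n
n[k+1]≤m+2n⇒n[k∸1]≤m n (suc j) m le =
  +-cancelʳ-≤ (n + n) (n * j) m (subst (_≤ m + (n + n)) (n[k+1]≡n[k∸1]+2n n (suc j) (s≤s z≤n)) le)

module Caterpillar (n k : ℕ) where

  pathWeight : CatVertex n k → ℕ
  pathWeight (_ , zero)  = 1
  pathWeight (_ , suc _) = 0

  catAdj? : Decidable (CatAdj n k)
  catAdj? (i , zero) (j , zero) with toℕ j ≟ suc (toℕ i) | toℕ i ≟ suc (toℕ j)
  ... | yes j≡1+i | _         = yes (pathFwd j≡1+i)
  ... | no  _     | yes i≡1+j = yes (pathBwd i≡1+j)
  ... | no  j≢1+i | no i≢1+j  = no λ { (pathFwd j≡1+i) → j≢1+i j≡1+i ; (pathBwd i≡1+j) → i≢1+j i≡1+j }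
  catAdj? (i , zero) (j , suc l) with i ≟ᶠ j
  ... | yes refl = yes toLeaf
  ... | no  i≢j  = no λ { toLeaf → i≢j refl }
  catAdj? (i , suc l) (j , zero) with i ≟ᶠ j
  ... | yes refl = yes fromLeaf
  ... | no  i≢j  = no λ { fromLeaf → i≢j refl }
  catAdj? (_ , suc _) (_ , suc _) = no λ ()

  open MissingEdges catAdj?

  catAdj-covered : CoversEdges pathWeight
  catAdj-covered (pathFwd _) = s≤s z≤n
  catAdj-covered (pathBwd _) = s≤s z≤n
  catAdj-covered toLeaf      = s≤s z≤n
  catAdj-covered fromLeaf    = s≤s z≤n

  leaves-weightless : ∀ {m} i (f : Fin m → Fin k) →
                      All (λ v → pathWeight v ≡ 0) (map (i ,_) (tabulate (suc ∘ f)))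
  leaves-weightless i f = All.map⁺ (All.tabulate⁺ (λ _ → refl))

  vertices : List (CatVertex n k)
  vertices = cartesianProduct (allFin n) (allFin (suc k))

  vertices-unique : Unique vertices
  vertices-unique = Unique.cartesianProduct⁺ (Unique.allFin⁺ n) (Unique.allFin⁺ (suc k))

  vertices-complete : ∀ v → v ∈ vertices
  vertices-complete (i , l) = ∈-cartesianProduct⁺ (∈-allFin i) (∈-allFin l)

  length-vertices : length vertices ≡ n * suc k
  length-vertices = trans (length-cartesianProduct (allFin n) (allFin (suc k)))
                          (cong₂ _*_ (length-tabulate {n = n} id) (length-tabulate {n = suc k} id))

  pathWeight-vertices : weight pathWeight vertices ≡ n
  pathWeight-vertices = trans (count (allFin n)) (length-tabulate {n = n} id)
    where
    count : ∀ is → weight pathWeight (cartesianProduct is (allFin (suc k))) ≡ length is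
    count []       = refl
    count (i ∷ is) = begin
      weight pathWeight (map (i ,_) (allFin (suc k)) ++ cartesianProduct is (allFin (suc k)))
        ≡⟨ weight-++ pathWeight (map (i ,_) (allFin (suc k))) _ ⟩
      suc (weight pathWeight (map (i ,_) (tabulate suc))) + weight pathWeight (cartesianProduct is (allFin (suc k)))
        ≡⟨ cong₂ (λ a b → suc a + b) (weight-zero pathWeight (leaves-weightless i id)) (count is) ⟩
      suc (length is) ∎
      where open ≡-Reasoning

  ordering↭vertices : ∀ {c} → Unique c → (∀ v → v ∈ c) → c ↭ vertices
  ordering↭vertices c! c-complete = complete-unique⇒↭ c! vertices-unique c-complete vertices-complete

  length-cycleEdges-ordering : ∀ c → Unique c → (∀ v → v ∈ c) → length (cycleEdges c) ≡ n * suc k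
  length-cycleEdges-ordering c c! c-complete =
    trans (length-cycleEdges c) (trans (↭-length (ordering↭vertices c! c-complete)) length-vertices)

  pairWeight-cycleEdges-ordering : ∀ c → Unique c → (∀ v → v ∈ c) →
                                   sum (map (pairWeight pathWeight) (cycleEdges c)) ≡ n + n
  pairWeight-cycleEdges-ordering c c! c-complete =
    trans (pairWeight-cycleEdges pathWeight c) (cong₂ _+_ weight-c weight-c)
    where
    weight-c : weight pathWeight c ≡ n
    weight-c = trans (sum-↭ (↭.map⁺ pathWeight (ordering↭vertices c! c-complete))) pathWeight-vertices

  missingEdges-lowerBound : ∀ c → Unique c → (∀ v → v ∈ c) → n * (k ∸ 1) ≤ length (missingEdges c)
  missingEdges-lowerBound c c! c-complete = n[k+1]≤m+2n⇒n[k∸1]≤m n k (length (missingEdges c)) (begin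
    n * suc k
      ≡⟨ sym (length-cycleEdges-ordering c c! c-complete) ⟩
    length (cycleEdges c)
      ≤⟨ length≤missing+pairWeight pathWeight catAdj-covered (cycleEdges c) ⟩
    length (missingEdges c) + sum (map (pairWeight pathWeight) (cycleEdges c))
      ≡⟨ cong (length (missingEdges c) +_) (pairWeight-cycleEdges-ordering c c! c-complete) ⟩
    length (missingEdges c) + (n + n) ∎)
    where open ≤-Reasoning

module Tour (n′ j : ℕ) where

  n k : ℕ
  n = suc n′
  k = suc (suc j)

  open Caterpillar n k
  open MissingEdges catAdj?

  laterLeaf : Fin (suc j) → Fin (suc k)
  laterLeaf l = suc (suc l)

  blockOrder : List (Fin (suc k))
  blockOrder = suc zero ∷ zero ∷ tabulate laterLeaf

  blockOrder-unique : Unique blockOrder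
  blockOrder-unique = ((λ ()) ∷ All.tabulate⁺ {f = laterLeaf} (λ _ ()))
                    ∷ All.tabulate⁺ {f = laterLeaf} (λ _ ())
                    ∷ Unique.tabulate⁺ {f = laterLeaf} (suc-injective ∘ suc-injective)

  blockOrder-complete : ∀ l → l ∈ blockOrder
  blockOrder-complete zero          = there (here refl)
  blockOrder-complete (suc zero)    = here refl
  blockOrder-complete (suc (suc l)) = there (there (∈-tabulate⁺ {f = laterLeaf} l))

  tour : List (CatVertex n k)
  tour = cartesianProduct (allFin n) blockOrder

  tour-unique : Unique tour
  tour-unique = Unique.cartesianProduct⁺ (Unique.allFin⁺ n) blockOrder-unique

  tour-complete : ∀ v → v ∈ tour
  tour-complete (i , l) = ∈-cartesianProduct⁺ (∈-allFin i) (blockOrder-complete l)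

  3≤length-tour : 3 ≤ length tour
  3≤length-tour = s≤s (s≤s (s≤s z≤n))

  block-linked : ∀ i {v ys} → pathWeight v ≡ 0 → Linked (Tight pathWeight) (v ∷ ys) →
                 Linked (Tight pathWeight) (map (i ,_) blockOrder ++ v ∷ ys)
  block-linked i wv≡0 linked =
    inj₁ (fromLeaf , refl) ∷ inj₁ (toLeaf , refl)
    ∷ weightless-++⁺ pathWeight catAdj-covered (leaves-weightless i suc) wv≡0 linked

  blocks-linked : ∀ is {v ys} → pathWeight v ≡ 0 → Linked (Tight pathWeight) (v ∷ ys) →
                  Linked (Tight pathWeight) (cartesianProduct is blockOrder ++ v ∷ ys)
  blocks-linked []            _    linked = linked
  blocks-linked (i ∷ [])      {v} {ys} wv≡0 linked =
    subst (Linked (Tight pathWeight)) (sym (++-assoc (map (i ,_) blockOrder) [] (v ∷ ys)))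
          (block-linked i wv≡0 linked)
  blocks-linked (i ∷ i′ ∷ is) {v} {ys} wv≡0 linked =
    subst (Linked (Tight pathWeight)) (sym (++-assoc (map (i ,_) blockOrder) (cartesianProduct (i′ ∷ is) blockOrder) (v ∷ ys)))
          (block-linked i refl (blocks-linked (i′ ∷ is) wv≡0 linked))

  tour-tight : All (uncurry (Tight pathWeight)) (cycleEdges tour)
  -- closedWalk tour reduces to tour ++ [ (zero , suc zero) ], and that closing vertex is a leaf.
  tour-tight = Linked⇒All-steps (blocks-linked (allFin n) refl [-])

  missingEdges-tour : length (missingEdges tour) ≡ n * (k ∸ 1)
  missingEdges-tour = +-cancelʳ-≡ (n + n) _ _ (begin
    length (missingEdges tour) + (n + n)
      ≡⟨ cong (length (missingEdges tour) +_) (sym (pairWeight-cycleEdges-ordering tour tour-unique tour-complete)) ⟩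
    length (missingEdges tour) + sum (map (pairWeight pathWeight) (cycleEdges tour))
      ≡⟨ tight⇒missing+pairWeight≡length pathWeight (cycleEdges tour) tour-tight ⟩
    length (cycleEdges tour)
      ≡⟨ length-cycleEdges-ordering tour tour-unique tour-complete ⟩
    n * suc k
      ≡⟨ n[k+1]≡n[k∸1]+2n n k (s≤s z≤n) ⟩
    n * (k ∸ 1) + (n + n) ∎)
    where open ≡-Reasoning

mainTheorem3 : (n k : ℕ) → 1 ≤ n → 3 ≤ k →
    HamiltonianCompleteNumber (CatAdj n k) (n * (k ∸ 1))
mainTheorem3 _ (suc zero) _ (s≤s ())
-- The construction only needs k ≥ 2.
mainTheorem3 (suc n′) (suc (suc j)) _ _ =
  hamiltonianCompleteNumber-intro tour tour-unique tour-complete 3≤length-tour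
                                  missingEdges-tour missingEdges-lowerBound
  where
  open Tour n′ j
  open Caterpillar n k
  open MissingEdges catAdj?
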